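{- Let $G$ be a simple graph with $\bar{\gamma}_p(G)=0$ such that $G$ has a vertex of degree one or a cut-vertex. Then $G=P_n$ (the path on $n$ vertices) for some $n\ge 1$.
   Context: For $v\in V$, $N[v]$ is the closed neighborhood; for $S\subseteq V$, $N[S]=\bigcup_{v\in S}N[v]$. Define $\mathcal{P}^0(S)=N[S]$, $\mathcal{P}^{i+1}(S)=\mathcal{P}^i(S)\cup\{w : \{w\}=N[v]\setminus\mathcal{P}^i(S)\text{ for some } v\in\mathcal{P}^i(S)\}$, with eventual value $\mathcal{P}^\infty(S)$. $S$ is a power dominating set (PDS) if $\mathcal{P}^\infty(S)=V$, and a failed power dominating set (FPDS) otherwise. $\bar{\gamma}_p(G)$ is the maximum cardinality of an FPDS of $G$. -}

module Defs where

open import Data.Nat using (ℕ; zero; suc)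
open import Data.Bool using (Bool; true; false; T)
open import Data.Fin using (Fin; toℕ)
open import Data.Fin.Subset using (Subset; _∈_; ∣_∣)
open import Data.Vec using (tabulate)
open import Data.Product using (Σ; ∃; _×_)
open import Data.Sum using (_⊎_)
open import Relation.Nullary using (¬_)
open import Relation.Binary.PropositionalEquality using (_≡_; _≢_)
open import Function.Bundles using (_⤖_; Bijection)

record Graph (n : ℕ) : Set where
  field
    E     : Fin n → Fin n → Bool
    sym   : ∀ i j → E i j ≡ E j i
    loopless : ∀ i → E i i ≡ false

module _ {n : ℕ} (G : Graph n) where
  open Graph G

  Adj : Fin n → Fin n → Set
  Adj i j = T (E i j)

  InN : Fin n → Fin n → Set
  InN v w = (w ≡ v) ⊎ Adj v w

  Pw : ℕ → Subset n → Fin n → Set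
  Pw zero    S w = Σ (Fin n) λ v → (v ∈ S) × InN v w
  Pw (suc i) S w =
    Pw i S w ⊎
    (Σ (Fin n) λ v → Pw i S v × InN v w × ¬ Pw i S w
                   × (∀ u → InN v u → ¬ Pw i S u → u ≡ w))

  -- P^∞(S) = V  iff  P^i(S) = V for some i (the sequence is increasing)
  IsPDS : Subset n → Set
  IsPDS S = Σ ℕ λ i → ∀ w → Pw i S w

  IsFPDS : Subset n → Set
  IsFPDS S = ¬ IsPDS S

  -- γ̄_p(G) = 0 : the maximum cardinality of an FPDS exists and equals 0
  FailedPowerDomZero : Set
  FailedPowerDomZero =
    (Σ (Subset n) λ S → IsFPDS S × ∣ S ∣ ≡ 0) × (∀ S → IsFPDS S → ∣ S ∣ ≡ 0)

  degree : Fin n → ℕ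
  degree v = ∣ tabulate (E v) ∣

  data ReachIn (Q : Fin n → Set) : Fin n → Fin n → Set where
    here  : ∀ {u} → Q u → ReachIn Q u u
    there : ∀ {u x w} → Q u → Adj u x → ReachIn Q x w → ReachIn Q u w

  Connected : Fin n → Fin n → Set
  Connected = ReachIn (λ _ → ⊤′)
    where open import Data.Unit using () renaming (⊤ to ⊤′)

  IsCutVertex : Fin n → Set
  IsCutVertex v = Σ (Fin n) λ u → Σ (Fin n) λ w →
    u ≢ v × w ≢ v × Connected u w × ¬ ReachIn (λ x → x ≢ v) u w

pathE : {m : ℕ} → Fin m → Fin m → Bool
pathE i j = suc1 (toℕ i) (toℕ j)
  where
  open import Data.Nat using (_≡ᵇ_)
  open import Data.Bool using (_∨_)
  suc1 : ℕ → ℕ → Bool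
  suc1 a b = (suc a ≡ᵇ b) ∨ (suc b ≡ᵇ a)

_≅P_ : {n : ℕ} → Graph n → (m : ℕ) → Set
_≅P_ {n} G m = Σ (Fin n ⤖ Fin m) λ f →
  ∀ i j → Graph.E G i j ≡ pathE (Bijection.to f i) (Bijection.to f j)

-- If N[x] ⊆ T and no vertex of T has exactly one neighbour outside T, then
-- the power domination process started from {x} never leaves T.  Since
-- γ̄_p(G) = 0 makes every singleton a power dominating set, such a T is all
-- of V.  Now grow an induced path from a leaf (or, for a cut vertex v, from
-- v away from a component C of G − v, with C counted as covered) one forced
-- vertex at a time.  Every covered vertex except the growing end has all its
-- neighbours covered, so either the end forces and the path extends, or the
-- covered set is stuck and hence everything.  From a leaf this exhibits G as
-- a path; from a cut vertex the path must end in a leaf, so that case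
-- reduces to the first.
module Submission where

open import Defs
open import Data.Nat using (ℕ; _≥_)
open import Data.Fin using (Fin)
open import Data.Product using (Σ; _×_)
open import Data.Sum using (_⊎_)
open import Relation.Binary.PropositionalEquality using (_≡_)

open import Data.Bool using (Bool; true; false; T; T?)
open import Data.Bool.Properties using (T-≡; ∨-comm)
open import Data.Empty using (⊥; ⊥-elim)
open import Data.Fin using (zero; suc; toℕ; fromℕ)
open import Data.Fin.Properties using (any?; all?; injective⇒≤) renaming (_≟_ to _≟ᶠ_)
open import Data.Fin.Subset using (Subset; outside; inside; ⁅_⁆; _∈_; _⊆_; ∣_∣)
  renaming (⊥ to ∅)
open import Data.Fin.Subset.Properties using (x∈⁅x⁆; x∈⁅y⁆⇒x≡y; ∣⁅x⁆∣≡1; ⊆-antisym)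
open import Data.Nat using (zero; suc; _≤_; _+_; _≡ᵇ_; s≤s; z≤n)
open import Data.Nat.Properties
  using (+-suc; +-identityʳ; ≤-trans; m≤n+m; 1+n≰n; suc-injective; _≟_)
open import Data.Product using (_,_; proj₁; proj₂; ∃)
open import Data.Sum using (inj₁; inj₂; [_,_]; map₂)
open import Data.Unit using (tt)
open import Data.Vec as Vec using (tabulate)
open import Data.Vec.Functional using ([]; _∷_)
open import Data.Vec.Properties using ([]=⇒lookup; lookup⇒[]=; lookup∘tabulate)
open import Function using (_∘_; id)
open import Function.Bundles using (Equivalence; _⤖_; mk⤖)
open import Function.Construct.Symmetry using (⤖-sym)
open import Function.Definitions using (Injective)
open import Relation.Binary.PropositionalEquality using (_≢_; refl; sym; trans; cong; cong₂; subst)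
open import Relation.Nullary using (¬_; yes; no)
open import Relation.Nullary.Decidable
  using (_×-dec_; _⊎-dec_; _→-dec_; ¬?; ¬¬-excluded-middle)
open import Relation.Unary using (Decidable)

¬T⇒≡false : ∀ {b} → ¬ T b → b ≡ false
¬T⇒≡false {false} _  = refl
¬T⇒≡false {true}  ¬t = ⊥-elim (¬t tt)

¬¬-decidable : ∀ {n} (P : Fin n → Set) → ¬ ¬ Decidable P
¬¬-decidable {zero}  P k = k λ ()
¬¬-decidable {suc n} P k = ¬¬-excluded-middle λ P₀? → ¬¬-decidable (P ∘ suc) λ P₊? →
  k λ { zero → P₀? ; (suc i) → P₊? i }

∣p∣≡0⇒p≡∅ : ∀ {n} {p : Subset n} → ∣ p ∣ ≡ 0 → p ≡ ∅
∣p∣≡0⇒p≡∅ {p = Vec.[]}            _ = refl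
∣p∣≡0⇒p≡∅ {p = outside Vec.∷ p} e = cong (outside Vec.∷_) (∣p∣≡0⇒p≡∅ e)

∣p∣≡1⇒p≡⁅x⁆ : ∀ {n} {p : Subset n} → ∣ p ∣ ≡ 1 → ∃ λ x → p ≡ ⁅ x ⁆
∣p∣≡1⇒p≡⁅x⁆ {p = outside Vec.∷ p} e with ∣p∣≡1⇒p≡⁅x⁆ e
... | x , p≡⁅x⁆ = suc x , cong (outside Vec.∷_) p≡⁅x⁆
∣p∣≡1⇒p≡⁅x⁆ {p = inside Vec.∷ p} e =
  zero , cong (inside Vec.∷_) (∣p∣≡0⇒p≡∅ (suc-injective e))

∈-tabulate⁺ : ∀ {n} (f : Fin n → Bool) {i} → T (f i) → i ∈ tabulate f
∈-tabulate⁺ f {i} t =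
  lookup⇒[]= i (tabulate f) (trans (lookup∘tabulate f i) (Equivalence.to T-≡ t))

∈-tabulate⁻ : ∀ {n} (f : Fin n → Bool) {i} → i ∈ tabulate f → T (f i)
∈-tabulate⁻ f {i} i∈ = Equivalence.from T-≡ (trans (sym (lookup∘tabulate f i)) ([]=⇒lookup i∈))

pathE-sym : ∀ {m} (i j : Fin m) → pathE i j ≡ pathE j i
pathE-sym i j = ∨-comm (suc (toℕ i) ≡ᵇ toℕ j) (suc (toℕ j) ≡ᵇ toℕ i)

module _ {n : ℕ} (G : Graph n) where
  open Graph G using (E; loopless)

  Adj-sym : ∀ {u w} → Adj G u w → Adj G w u
  Adj-sym {u} {w} = subst T (Graph.sym G u w)

  Adj⇒≢ : ∀ {u w} → Adj G u w → u ≢ w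
  Adj⇒≢ {u} u~u refl = subst T (loopless u) u~u

  ReachIn-end : ∀ {Q a b} → ReachIn G Q a b → Q b
  ReachIn-end (here Qb)      = Qb
  ReachIn-end (there _ _ r)  = ReachIn-end r

  ReachIn-snoc : ∀ {Q a b d} → ReachIn G Q a b → Adj G b d → Q d → ReachIn G Q a d
  ReachIn-snoc (here Qa)        a~d Qd = there Qa a~d (here Qd)
  ReachIn-snoc (there Qa a~x r) b~d Qd = there Qa a~x (ReachIn-snoc r b~d Qd)

  degree≡1⇒uniqueNeighbour : ∀ v → degree G v ≡ 1 →
    ∃ λ p → Adj G v p × (∀ w → Adj G v w → w ≡ p)
  degree≡1⇒uniqueNeighbour v deg with ∣p∣≡1⇒p≡⁅x⁆ deg
  ... | p , N≡⁅p⁆ =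
    p , ∈-tabulate⁻ (E v) (subst (p ∈_) (sym N≡⁅p⁆) (x∈⁅x⁆ p))
      , λ w v~w → x∈⁅y⁆⇒x≡y p (subst (w ∈_) N≡⁅p⁆ (∈-tabulate⁺ (E v) v~w))

  uniqueNeighbour⇒degree≡1 : ∀ {v p} → Adj G v p → (∀ w → Adj G v w → w ≡ p) →
    degree G v ≡ 1
  uniqueNeighbour⇒degree≡1 {v} {p} v~p unique =
    trans (cong ∣_∣ (⊆-antisym N⊆⁅p⁆ ⁅p⁆⊆N)) (∣⁅x⁆∣≡1 p)
    where
    N⊆⁅p⁆ : tabulate (E v) ⊆ ⁅ p ⁆
    N⊆⁅p⁆ {w} w∈N = subst (_∈ ⁅ p ⁆) (sym (unique w (∈-tabulate⁻ (E v) w∈N))) (x∈⁅x⁆ p)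
    ⁅p⁆⊆N : ⁅ p ⁆ ⊆ tabulate (E v)
    ⁅p⁆⊆N {w} w∈⁅p⁆ =
      subst (_∈ tabulate (E v)) (sym (x∈⁅y⁆⇒x≡y p w∈⁅p⁆)) (∈-tabulate⁺ (E v) v~p)

  spanning-induced-path⇒≅P : ∀ {m} (c : Fin m → Fin n) → Injective _≡_ _≡_ c →
    (∀ w → ∃ λ i → c i ≡ w) → (∀ i j → E (c i) (c j) ≡ pathE i j) → G ≅P m
  spanning-induced-path⇒≅P {m} c injective onto induced = ⤖-sym c⤖ , λ u w →
    trans (cong₂ E (sym (proj₂ (onto u))) (sym (proj₂ (onto w)))) (induced _ _)
    where
    c⤖ : Fin m ⤖ Fin n
    c⤖ = mk⤖ {to = c} (injective , λ w → proj₁ (onto w) , λ { refl → proj₂ (onto w) })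

  Forces : (Fin n → Set) → Fin n → Fin n → Set
  Forces T y w = Adj G y w × ¬ T w × (∀ u → Adj G y u → ¬ T u → u ≡ w)

  Stalled : (Fin n → Set) → Set
  Stalled T = ∀ y w → T y → ¬ Forces T y w

  stalled⇒forced∈ : ∀ {T y w} → Decidable T → Stalled T → T y → InN G y w →
    (∀ u → Adj G y u → ¬ T u → u ≡ w) → T w
  stalled⇒forced∈ {w = w} T? stalled Ty w∈N[y] unique with T? w | w∈N[y]
  ... | yes Tw | _         = Tw
  ... | no _   | inj₁ refl = Ty
  ... | no ¬Tw | inj₂ y~w  = ⊥-elim (stalled _ w Ty (y~w , ¬Tw , unique))

  Pw⊆stalled : ∀ {T S} → Decidable T → (∀ v w → v ∈ S → InN G v w → T w) → Stalled T →
    ∀ i w → Pw G i S w → T w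
  Pw⊆stalled T? N[S]⊆T stalled zero w (v , v∈S , w∈N[v]) = N[S]⊆T v w v∈S w∈N[v]
  Pw⊆stalled T? N[S]⊆T stalled (suc i) w (inj₁ w∈Pᵢ) = Pw⊆stalled T? N[S]⊆T stalled i w w∈Pᵢ
  Pw⊆stalled {T} {S} T? N[S]⊆T stalled (suc i) w (inj₂ (v , v∈Pᵢ , w∈N[v] , _ , unique)) =
    stalled⇒forced∈ T? stalled (Pᵢ⊆T v v∈Pᵢ) w∈N[v]
      λ u v~u ¬Tu → unique u (inj₂ v~u) (¬Tu ∘ Pᵢ⊆T u)
    where
    Pᵢ⊆T : ∀ u → Pw G i S u → T u
    Pᵢ⊆T = Pw⊆stalled T? N[S]⊆T stalled i

  module _ (noFPDS : ∀ S → IsFPDS G S → ∣ S ∣ ≡ 0) where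

    singleton-not-failed : ∀ x → ¬ IsFPDS G ⁅ x ⁆
    singleton-not-failed x fails with trans (sym (∣⁅x⁆∣≡1 x)) (noFPDS ⁅ x ⁆ fails)
    ... | ()

    stalled-⊇N[x]-is-everything : ∀ {T} x → Decidable T → (∀ w → InN G x w → T w) →
      Stalled T → ∀ w → T w
    stalled-⊇N[x]-is-everything {T} x T? N[x]⊆T stalled w with T? w
    ... | yes Tw = Tw
    ... | no ¬Tw = ⊥-elim (singleton-not-failed x λ (i , Pᵢ≡V) →
                     ¬Tw (Pw⊆stalled T? N[⁅x⁆]⊆T stalled i w (Pᵢ≡V w)))
      where
      N[⁅x⁆]⊆T : ∀ v w → v ∈ ⁅ x ⁆ → InN G v w → T w
      N[⁅x⁆]⊆T v w v∈⁅x⁆ with x∈⁅y⁆⇒x≡y x v∈⁅x⁆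
      ... | refl = N[x]⊆T w

    module Growth (B : Fin n → Set) (B? : Decidable B) (root : Fin n)
                  (B-boundary : ∀ y w → B y → Adj G y w → B w ⊎ w ≡ root) (x : Fin n) where

      Covered : ∀ {m} → (Fin m → Fin n) → Fin n → Set
      Covered c w = B w ⊎ ∃ λ i → c i ≡ w

      covered? : ∀ {m} (c : Fin m → Fin n) → Decidable (Covered c)
      covered? c w = B? w ⊎-dec any? (λ i → c i ≟ᶠ w)

      B-neighbour-covered : ∀ {m} (c : Fin m → Fin n) {i} → c i ≡ root →
        ∀ y w → B y → Adj G y w → Covered c w
      B-neighbour-covered c {i} cᵢ≡root y w By y~w =
        map₂ (λ w≡root → i , trans cᵢ≡root (sym w≡root)) (B-boundary y w By y~w)

      -- The chain grows at index zero, its tip; the root stays at the last index.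
      record Chain (k : ℕ) : Set where
        field
          vertex             : Fin (suc k) → Fin n
          injective          : Injective _≡_ _≡_ vertex
          induced            : ∀ i j → E (vertex i) (vertex j) ≡ pathE i j
          ends-at-root       : vertex (fromℕ k) ≡ root
          avoids-B           : ∀ i → ¬ B (vertex i)
          interior-saturated : ∀ i w → Adj G (vertex (suc i)) w → Covered vertex w
          covers-N[x]        : ∀ w → InN G x w → Covered vertex w

        tip : Fin n
        tip = vertex zero

      open Chain public

      only-tip-can-force : ∀ {k} (ch : Chain k) y w → Covered (vertex ch) y → Adj G y w →
        ¬ Covered (vertex ch) w → y ≡ tip ch
      only-tip-can-force ch y w (inj₁ By) y~w ¬Cw =
        ⊥-elim (¬Cw (B-neighbour-covered (vertex ch) (ends-at-root ch) y w By y~w))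
      only-tip-can-force ch y w (inj₂ (zero , refl)) y~w ¬Cw = refl
      only-tip-can-force ch y w (inj₂ (suc i , refl)) y~w ¬Cw =
        ⊥-elim (¬Cw (interior-saturated ch i w y~w))

      stalled-unless-tip-forces : ∀ {k} (ch : Chain k) →
        (∀ w → ¬ Forces (Covered (vertex ch)) (tip ch) w) → Stalled (Covered (vertex ch))
      stalled-unless-tip-forces ch idle y w Cy force@(y~w , ¬Cw , _)
        with only-tip-can-force ch y w Cy y~w ¬Cw
      ... | refl = idle w force

      tip-forces? : ∀ {k} (ch : Chain k) → Decidable (Forces (Covered (vertex ch)) (tip ch))
      tip-forces? ch w =
        T? (E (tip ch) w) ×-dec ¬? (covered? (vertex ch) w) ×-dec
        all? (λ u → T? (E (tip ch) u) →-dec ¬? (covered? (vertex ch) u) →-dec u ≟ᶠ w)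

      extend : ∀ {k z} (ch : Chain k) → Forces (Covered (vertex ch)) (tip ch) z →
        Chain (suc k)
      extend {k} {z} ch (tip~z , ¬Cz , unique) = record
        { vertex             = z ∷ vertex ch
        ; injective          = injective′
        ; induced            = induced′
        ; ends-at-root       = ends-at-root ch
        ; avoids-B           = λ { zero → ¬Cz ∘ inj₁ ; (suc i) → avoids-B ch i }
        ; interior-saturated = interior-saturated′
        ; covers-N[x]        = λ w → covered-later ∘ covers-N[x] ch w
        }
        where
        covered-later : ∀ {w} → Covered (vertex ch) w → Covered (z ∷ vertex ch) w
        covered-later = map₂ λ (i , vᵢ≡w) → suc i , vᵢ≡w

        injective′ : Injective _≡_ _≡_ (z ∷ vertex ch)
        injective′ {zero}  {zero}  _ = refl
        injective′ {zero}  {suc j} e = ⊥-elim (¬Cz (inj₂ (j , sym e)))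
        injective′ {suc i} {zero}  e = ⊥-elim (¬Cz (inj₂ (i , e)))
        injective′ {suc i} {suc j} e = cong suc (injective ch e)

        z-sees-only-tip : ∀ j → E z (vertex ch j) ≡ pathE {suc (suc k)} zero (suc j)
        z-sees-only-tip zero    = Equivalence.to T-≡ (Adj-sym tip~z)
        z-sees-only-tip (suc j) =
          trans (Graph.sym G z _) (¬T⇒≡false (¬Cz ∘ interior-saturated ch j z))

        induced′ : ∀ i j → E ((z ∷ vertex ch) i) ((z ∷ vertex ch) j) ≡ pathE i j
        induced′ zero    zero    = loopless z
        induced′ zero    (suc j) = z-sees-only-tip j
        induced′ (suc i) zero    =
          trans (Graph.sym G _ z) (trans (z-sees-only-tip i) (pathE-sym zero (suc i)))
        induced′ (suc i) (suc j) = induced ch i j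

        interior-saturated′ : ∀ i w → Adj G (vertex ch i) w → Covered (z ∷ vertex ch) w
        interior-saturated′ (suc i) w a = covered-later (interior-saturated ch i w a)
        interior-saturated′ zero w tip~w with covered? (vertex ch) w
        ... | yes Cw  = covered-later Cw
        ... | no ¬Cw = inj₂ (zero , sym (unique w tip~w ¬Cw))

      CoveringChain : Set
      CoveringChain = Σ ℕ λ k → Σ (Chain k) λ ch → ∀ w → Covered (vertex ch) w

      -- An injective chain has at most n vertices, so the fuel bounds the
      -- number of extensions still possible.
      grow : ∀ fuel {k} → n ≤ k + fuel → Chain k → CoveringChain
      grow zero {k} n≤k ch =
        ⊥-elim (1+n≰n (≤-trans (injective⇒≤ (injective ch))
                               (subst (n ≤_) (+-identityʳ k) n≤k)))
      grow (suc fuel) {k} n≤ ch with any? (tip-forces? ch)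
      ... | yes (z , force) = grow fuel (subst (n ≤_) (+-suc k fuel) n≤) (extend ch force)
      ... | no idle = k , ch ,
        stalled-⊇N[x]-is-everything x (covered? (vertex ch)) (covers-N[x] ch)
          (stalled-unless-tip-forces ch λ w force → idle (w , force))

      grow-from : ∀ {k} → Chain k → CoveringChain
      grow-from {k} = grow n (m≤n+m n k)

      covering-chain-ends-in-leaf : ∀ {k} (ch : Chain (suc k)) →
        (∀ w → Covered (vertex ch) w) → degree G (tip ch) ≡ 1
      covering-chain-ends-in-leaf {k} ch cover =
        uniqueNeighbour⇒degree≡1 (subst T (sym (induced ch zero (suc zero))) tt) only-neighbour
        where
        tip≢root : tip ch ≢ root
        tip≢root tip≡root with injective ch (trans tip≡root (sym (ends-at-root ch)))
        ... | ()

        second-on-path : ∀ j → T (pathE {suc (suc k)} zero j) → j ≡ suc zero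
        second-on-path (suc zero) _ = refl

        only-neighbour : ∀ w → Adj G (tip ch) w → w ≡ vertex ch (suc zero)
        only-neighbour w tip~w with cover w
        ... | inj₁ Bw =
          ⊥-elim ([ avoids-B ch zero , tip≢root ] (B-boundary w (tip ch) Bw (Adj-sym tip~w)))
        ... | inj₂ (j , refl) =
          cong (vertex ch) (second-on-path j (subst T (induced ch zero j) tip~w))

    leaf⇒path : ∀ u → degree G u ≡ 1 → Σ ℕ λ m → (m ≥ 1) × (G ≅P m)
    leaf⇒path u deg with degree≡1⇒uniqueNeighbour u deg
    ... | p , u~p , unique = conclude (grow-from start)
      where
      open Growth (λ _ → ⊥) (λ _ → no id) u (λ _ _ ()) u

      start : Chain 1
      start = record
        { vertex             = p ∷ u ∷ []
        ; injective          = λ { {zero}     {zero}     _   → refl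
                                 ; {zero}     {suc zero} p≡u → ⊥-elim (Adj⇒≢ u~p (sym p≡u))
                                 ; {suc zero} {zero}     u≡p → ⊥-elim (Adj⇒≢ u~p u≡p)
                                 ; {suc zero} {suc zero} _   → refl }
        ; induced            = λ { zero       zero       → loopless p
                                 ; zero       (suc zero) → Equivalence.to T-≡ (Adj-sym u~p)
                                 ; (suc zero) zero       → Equivalence.to T-≡ u~p
                                 ; (suc zero) (suc zero) → loopless u }
        ; ends-at-root       = refl
        ; avoids-B           = λ _ ()
        ; interior-saturated = λ { zero w u~w → inj₂ (zero , sym (unique w u~w)) }
        ; covers-N[x]        = λ { w (inj₁ refl) → inj₂ (suc zero , refl)
                                 ; w (inj₂ u~w)  → inj₂ (zero , sym (unique w u~w)) }
        }

      conclude : CoveringChain → Σ ℕ λ m → (m ≥ 1) × (G ≅P m)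
      conclude (k , ch , cover) =
        suc k , s≤s z≤n ,
        spanning-induced-path⇒≅P (vertex ch) (injective ch) ([ ⊥-elim , id ] ∘ cover) (induced ch)

    -- Stated under ¬¬ so that membership in the component of u in G − v may be
    -- assumed decidable.
    cut-vertex⇒¬¬leaf : ∀ v → IsCutVertex G v → ¬ ¬ (∃ λ y → degree G y ≡ 1)
    cut-vertex⇒¬¬leaf v (u , w , u≢v , w≢v , _ , u↛w) noLeaf =
      ¬¬-decidable (ReachIn G Avoids-v u) refuted
      where
      Avoids-v : Fin n → Set
      Avoids-v y = y ≢ v

      boundary : ∀ y z → ReachIn G Avoids-v u y → Adj G y z → ReachIn G Avoids-v u z ⊎ z ≡ v
      boundary y z u⇝y y~z with z ≟ᶠ v
      ... | yes z≡v = inj₂ z≡v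
      ... | no z≢v  = inj₁ (ReachIn-snoc u⇝y y~z z≢v)

      module _ (B? : Decidable (ReachIn G Avoids-v u)) where
        open Growth (ReachIn G Avoids-v u) B? v boundary u

        start : Chain 0
        start = record
          { vertex             = v ∷ []
          ; injective          = λ { {zero} {zero} _ → refl }
          ; induced            = λ { zero zero → loopless v }
          ; ends-at-root       = refl
          ; avoids-B           = λ { zero u⇝v → ReachIn-end u⇝v refl }
          ; interior-saturated = λ ()
          ; covers-N[x]        = λ { w (inj₁ refl) → inj₁ (here u≢v)
                                   ; w (inj₂ u~w) →
                                       B-neighbour-covered (v ∷ []) {zero} refl u w (here u≢v) u~w }
          }

        conclude : CoveringChain → ⊥
        conclude (zero  , ch , cover) =
          [ u↛w , (λ { (zero , v≡w) → w≢v (trans (sym v≡w) (ends-at-root ch)) }) ] (cover w)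
        conclude (suc k , ch , cover) = noLeaf (tip ch , covering-chain-ends-in-leaf ch cover)

        refuted : ⊥
        refuted = conclude (grow-from start)

theorem5 : (n : ℕ) (G : Graph n) → FailedPowerDomZero G →
    ((Σ (Fin n) λ v → degree G v ≡ 1) ⊎ (Σ (Fin n) λ v → IsCutVertex G v)) →
    Σ ℕ λ m → (m ≥ 1) × (G ≅P m)
theorem5 n G (_ , noFPDS) (inj₁ (u , deg)) = leaf⇒path G noFPDS u deg
theorem5 n G (_ , noFPDS) (inj₂ (v , cut)) with any? (λ y → degree G y ≟ 1)
... | yes (u , deg) = leaf⇒path G noFPDS u deg
... | no noLeaf     = ⊥-elim (cut-vertex⇒¬¬leaf G noFPDS v cut noLeaf)
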